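{- Let $b\ge 2$, $n\ge 0$ and $i\ge 0$ be integers. The map $r_i$ defined on $P_i(b,n)$ by deleting the first $i$ components, $r_i(p_0,p_1,\dots)=(p_i,p_{i+1},\dots)$, is a bijection from $P_i(b,n)$ onto $R_b\!\left(\frac{n+1}{b^i}-1\right)$.
   Context: For an integer $m\ge 0$, a $b$-ary partition of $m$ is a sequence $p=(p_0,p_1,\dots)$ of non-negative integers, only finitely many nonzero, with $\sum_{j\ge0}p_jb^j=m$ (written as finite tuples, later components being $0$). Firing $j$ (allowed when $p_j\ge b$) replaces $p_j$ by $p_j-b$ and $p_{j+1}$ by $p_{j+1}+1$. $R_b(m)$ is the set of $b$-ary partitions of $m$ obtainable from $(m,0,0,\dots)$ by finitely many firings; by convention $R_b(x)=\emptyset$ when $x$ is not a non-negative integer. For $i\ge 0$, $P_i(b,n)$ is the set of $p\in R_b(n)$ with $p_0=p_1=\dots=p_{i-1}=b-1$. -}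

module Defs where

open import Data.Nat using (ℕ; zero; suc; _+_; _*_; _∸_; _^_; _≤_; _≟_)
open import Data.Product using (Σ; _×_; ∃)
open import Relation.Nullary using (yes; no)
open import Relation.Binary.PropositionalEquality using (_≡_; _≗_)

-- A b-ary partition is a sequence ℕ → ℕ (finite support is automatic for
-- every sequence reachable from (m,0,0,…)); sequences are compared pointwise (_≗_).
Seq : Set
Seq = ℕ → ℕ

initial : ℕ → Seq
initial m zero    = m
initial m (suc k) = 0

fire : ℕ → ℕ → Seq → Seq
fire b j p k with k ≟ j
... | yes _ = p k ∸ b
... | no _ with k ≟ suc j
...   | yes _ = p k + 1
...   | no _  = p k

-- Reach b m p : p ∈ R_b(m), i.e. p is obtained from (m,0,0,…) by finitely many
-- legal firings (p_j ≥ b); stated up to pointwise equality of sequences.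
data Reach (b m : ℕ) : Seq → Set where
  start : ∀ {p} → p ≗ initial m → Reach b m p
  step  : ∀ {p q} j → Reach b m p → b ≤ p j → q ≗ fire b j p → Reach b m q

InP : ℕ → ℕ → ℕ → Seq → Set
InP i b n p = Reach b n p × (∀ k → suc k ≤ i → p k ≡ b ∸ 1)

-- q ∈ R_b((n+1)/b^i - 1): since n+1 ≥ 1, (n+1)/b^i - 1 is a non-negative integer
-- m iff (m+1)·b^i = n+1; otherwise R_b(·) = ∅.
InTarget : ℕ → ℕ → ℕ → Seq → Set
InTarget i b n q = Σ ℕ λ m → (suc m * b ^ i ≡ suc n) × Reach b m q

r : ℕ → Seq → Seq
r i p k = p (i + k)

-- A partition p lies in R_b(m) exactly when its tail (p_1, p_2, …) lies in R_b(m′) for the m′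
-- with p_0 + b·m′ = m: firings at positions ≥ 1 are firings of the tail, and a firing at 0
-- only moves b units of p_0 into one unit of p_1.  Conversely (a + b·m′, 0, …) reaches
-- (a, m′, 0, …) by m′ firings at 0, after which the tail replays its own derivation.
-- Hence deleting a leading component b − 1 maps P_1(b,n) bijectively onto R_b((n+1)/b − 1),
-- and the theorem follows by induction on i.
module Submission where

open import Defs
open import Data.Nat using (ℕ; zero; suc; _+_; _*_; _∸_; _^_; _≤_; _≟_; _≤?_; s≤s; z≤n; pred; NonZero)
open import Data.Nat.Properties
open import Data.Product using (Σ; _×_; _,_)
open import Data.Empty using (⊥-elim)
open import Function using (_∘_)
open import Relation.Nullary using (Dec; yes; no; ¬_)
open import Relation.Binary.PropositionalEquality
open import Algebra.Properties.CommutativeSemigroup *-commutativeSemigroup using (x∙yz≈y∙xz)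

cons : ℕ → Seq → Seq
cons a p zero    = a
cons a p (suc k) = p k

tail : Seq → Seq
tail p k = p (suc k)

incr-head : Seq → Seq
incr-head t zero    = t zero + 1
incr-head t (suc k) = t (suc k)

cons-cong : ∀ {a a′ p p′} → a ≡ a′ → p ≗ p′ → cons a p ≗ cons a′ p′
cons-cong a≡a′ p≗p′ zero    = a≡a′
cons-cong a≡a′ p≗p′ (suc k) = p≗p′ k

initial≗cons : ∀ m → initial m ≗ cons m (initial 0)
initial≗cons m zero          = refl
initial≗cons m (suc zero)    = refl
initial≗cons m (suc (suc k)) = refl

incr-head-initial : ∀ m → incr-head (initial m) ≗ initial (suc m)
incr-head-initial m zero    = +-comm m 1
incr-head-initial m (suc k) = refl

fire-at : ∀ b j p → fire b j p j ≡ p j ∸ b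
fire-at b j p with j ≟ j
... | yes _ = refl
... | no j≢j = ⊥-elim (j≢j refl)

fire-next : ∀ b j p → fire b j p (suc j) ≡ p (suc j) + 1
fire-next b j p with suc j ≟ j
... | yes 1+j≡j = ⊥-elim (1+n≢n 1+j≡j)
... | no _ with suc j ≟ suc j
...   | yes _ = refl
...   | no j≢j = ⊥-elim (j≢j refl)

fire-other : ∀ b j p k → ¬ k ≡ j → ¬ k ≡ suc j → fire b j p k ≡ p k
fire-other b j p k k≢j k≢1+j with k ≟ j
... | yes k≡j = ⊥-elim (k≢j k≡j)
... | no _ with k ≟ suc j
...   | yes k≡1+j = ⊥-elim (k≢1+j k≡1+j)
...   | no _ = refl

fire-zero : ∀ b p → fire b 0 p ≗ cons (p 0 ∸ b) (incr-head (tail p))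
fire-zero b p zero          = fire-at b 0 p
fire-zero b p (suc zero)    = fire-next b 0 p
fire-zero b p (suc (suc k)) = fire-other b 0 p (suc (suc k)) (λ ()) (λ ())

fire-suc : ∀ b j p → fire b (suc j) p ≗ cons (p 0) (fire b j (tail p))
fire-suc b j p zero = fire-other b (suc j) p 0 (λ ()) (λ ())
fire-suc b j p (suc k) = shifted (k ≟ j) (k ≟ suc j)
  where
  shifted : Dec (k ≡ j) → Dec (k ≡ suc j) → fire b (suc j) p (suc k) ≡ fire b j (tail p) k
  shifted (yes refl) _ = trans (fire-at b (suc k) p) (sym (fire-at b k (tail p)))
  shifted (no _) (yes refl) = trans (fire-next b (suc j) p) (sym (fire-next b j (tail p)))
  shifted (no k≢j) (no k≢1+j) =
    trans (fire-other b (suc j) p (suc k) (k≢j ∘ suc-injective) (k≢1+j ∘ suc-injective))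
          (sym (fire-other b j (tail p) k k≢j k≢1+j))

incr-head-fire : ∀ b j t → b ≤ t j → fire b j (incr-head t) ≗ incr-head (fire b j t)
incr-head-fire b zero t b≤t₀ zero =
  trans (fire-at b 0 (incr-head t)) (trans (+-∸-comm 1 b≤t₀) (cong (_+ 1) (sym (fire-at b 0 t))))
incr-head-fire b zero t _ (suc k) = trans (fire-zero b (incr-head t) (suc k)) (sym (fire-zero b t (suc k)))
incr-head-fire b (suc j) t _ zero = trans (fire-suc b j (incr-head t) 0) (cong (_+ 1) (sym (fire-suc b j t 0)))
incr-head-fire b (suc j) t _ (suc k) = trans (fire-suc b j (incr-head t) (suc k)) (sym (fire-suc b j t (suc k)))

Reach-resp-≗ : ∀ {b m p p′} → Reach b m p → p ≗ p′ → Reach b m p′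
Reach-resp-≗ (start p≗init)        p≗p′ = start (λ k → trans (sym (p≗p′ k)) (p≗init k))
Reach-resp-≗ (step j R b≤pj p≗fire) p≗p′ = step j R b≤pj (λ k → trans (sym (p≗p′ k)) (p≗fire k))

Reach-incr-head : ∀ {b m t} → Reach b m t → Reach b (suc m) (incr-head t)
Reach-incr-head {m = m} (start t≗init) = start init
  where
  init : ∀ k → incr-head _ k ≡ initial (suc m) k
  init zero    = trans (cong (_+ 1) (t≗init 0)) (+-comm m 1)
  init (suc k) = t≗init (suc k)
Reach-incr-head {b} (step {p} j R b≤pj q≗fire) =
  step j (Reach-incr-head R) (incr-head-≥ j b≤pj)
       (λ k → trans (incr-head-cong k) (sym (incr-head-fire b j p b≤pj k)))
  where
  incr-head-≥ : ∀ j → b ≤ p j → b ≤ incr-head p j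
  incr-head-≥ zero    b≤p₀ = m≤n⇒m≤n+o 1 b≤p₀
  incr-head-≥ (suc j) b≤pj = b≤pj
  incr-head-cong : ∀ k → incr-head _ k ≡ incr-head (fire b j p) k
  incr-head-cong zero    = cong (_+ 1) (q≗fire 0)
  incr-head-cong (suc k) = q≗fire (suc k)

Reach-tail : ∀ {b m p} → Reach b m p → Σ ℕ λ m′ → (p 0 + b * m′ ≡ m) × Reach b m′ (tail p)
Reach-tail {b} {m} (start p≗init) =
  0 , trans (cong₂ _+_ (p≗init 0) (*-zeroʳ b)) (+-identityʳ m) ,
  start (λ k → trans (p≗init (suc k)) (initial≗cons m (suc k)))
Reach-tail {b} {m} (step {p} {q} zero R b≤p₀ q≗fire) with Reach-tail R
... | m′ , p₀+bm′≡m , R′ =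
  suc m′ , weight ,
  Reach-resp-≗ (Reach-incr-head R′) (λ k → sym (trans (q≗fire (suc k)) (fire-zero b p (suc k))))
  where
  open ≡-Reasoning
  weight : q 0 + b * suc m′ ≡ m
  weight = begin
    q 0 + b * suc m′           ≡⟨ cong₂ _+_ (trans (q≗fire 0) (fire-at b 0 p)) (*-suc b m′) ⟩
    (p 0 ∸ b) + (b + b * m′)   ≡⟨ sym (+-assoc (p 0 ∸ b) b (b * m′)) ⟩
    (p 0 ∸ b + b) + b * m′     ≡⟨ cong (_+ b * m′) (m∸n+n≡m b≤p₀) ⟩
    p 0 + b * m′               ≡⟨ p₀+bm′≡m ⟩
    m                          ∎
Reach-tail {b} (step {p} {q} (suc j) R b≤pj q≗fire) with Reach-tail R
... | m′ , p₀+bm′≡m , R′ =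
  m′ , trans (cong (_+ b * m′) (trans (q≗fire 0) (fire-suc b j p 0))) p₀+bm′≡m ,
  step j R′ b≤pj (λ k → trans (q≗fire (suc k)) (fire-suc b j p (suc k)))

Reach-drain-head : ∀ {b M} x c y →
  Reach b M (cons (x + b * c) (initial y)) → Reach b M (cons x (initial (y + c)))
Reach-drain-head {b} x zero y R =
  Reach-resp-≗ R (cons-cong (trans (cong (x +_) (*-zeroʳ b)) (+-identityʳ x))
                            (λ k → cong (λ z → initial z k) (sym (+-identityʳ y))))
Reach-drain-head {b} x (suc c) y R =
  Reach-resp-≗ (Reach-drain-head x c (suc y) (step 0 R′ (m≤n+m b (x + b * c)) fired))
               (λ k → cong (λ z → cons x (initial z) k) (sym (+-suc y c)))
  where
  R′ : Reach b _ (cons ((x + b * c) + b) (initial y))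
  R′ = Reach-resp-≗ R (cons-cong (trans (cong (x +_) (trans (*-suc b c) (+-comm b (b * c))))
                                        (sym (+-assoc x (b * c) b)))
                                 (λ _ → refl))
  fired : cons (x + b * c) (initial (suc y)) ≗ fire b 0 (cons ((x + b * c) + b) (initial y))
  fired k = sym (trans (fire-zero b _ k)
                       (cons-cong (m+n∸n≡m (x + b * c) b) (incr-head-initial y) k))

Reach-replay-tail : ∀ {b m′ t M a} → Reach b m′ t → Reach b M (cons a (initial m′)) → Reach b M (cons a t)
Reach-replay-tail (start t≗init) R = Reach-resp-≗ R (cons-cong refl (λ k → sym (t≗init k)))
Reach-replay-tail {b} {a = a} (step {p} j R₀ b≤pj q≗fire) R =
  step (suc j) (Reach-replay-tail R₀ R) b≤pj
       (λ k → trans (cons-cong refl q≗fire k) (sym (fire-suc b j (cons a p) k)))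

Reach-cons : ∀ {b m′ t} a → Reach b m′ t → Reach b (a + b * m′) (cons a t)
Reach-cons {b} {m′} a R =
  Reach-replay-tail R (Reach-drain-head a m′ 0 (start (λ k → sym (initial≗cons (a + b * m′) k))))

InP-tail : ∀ {b i n p} → InP (suc i) b n p → Σ ℕ λ n′ → (b ∸ 1 + b * n′ ≡ n) × InP i b n′ (tail p)
InP-tail {b} (R , prefix) with Reach-tail R
... | n′ , p₀+bn′≡n , R′ =
  n′ , trans (cong (_+ b * n′) (sym (prefix 0 (s≤s z≤n)))) p₀+bn′≡n , R′ , λ k k<i → prefix (suc k) (s≤s k<i)

InP-cons : ∀ {b i n n′ p} → b ∸ 1 + b * n′ ≡ n → InP i b n′ p → InP (suc i) b n (cons (b ∸ 1) p)
InP-cons {b} {p = p} e (R , prefix) = subst (λ z → Reach b z (cons (b ∸ 1) p)) e (Reach-cons (b ∸ 1) R) , prefix′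
  where
  prefix′ : ∀ k → suc k ≤ suc _ → cons (b ∸ 1) p k ≡ b ∸ 1
  prefix′ zero    _         = refl
  prefix′ (suc k) (s≤s k<i) = prefix k k<i

module _ {b : ℕ} .{{_ : NonZero b}} where

  digit-step : ∀ m n′ i → suc m * b ^ i ≡ suc n′ → suc (b ∸ 1 + b * n′) ≡ suc m * b ^ suc i
  digit-step m n′ i e = begin
    suc (b ∸ 1) + b * n′    ≡⟨ cong (_+ b * n′) (suc-pred b) ⟩
    b + b * n′              ≡⟨ sym (*-suc b n′) ⟩
    b * suc n′              ≡⟨ cong (b *_) (sym e) ⟩
    b * (suc m * b ^ i)     ≡⟨ x∙yz≈y∙xz b (suc m) (b ^ i) ⟩
    suc m * (b * b ^ i)     ∎
    where open ≡-Reasoning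

  suc-pred-multiple : ∀ m i → suc (pred (suc m * b ^ i)) ≡ suc m * b ^ i
  suc-pred-multiple m i = suc-pred (suc m * b ^ i) {{m*n≢0 (suc m) (b ^ i) {{_}} {{m^n≢0 b i}}}}

  r-InTarget : ∀ i n p → InP i b n p → InTarget i b n (r i p)
  r-InTarget zero    n p (R , _) = n , *-identityʳ (suc n) , R
  r-InTarget (suc i) n p P with InP-tail P
  ... | n′ , digit , P′ with r-InTarget i n′ (tail p) P′
  ...   | m , e , R = m , trans (sym (digit-step m n′ i e)) (cong suc digit) , R

  r-surjective : ∀ i n q → InTarget i b n q → Σ Seq (λ p → InP i b n p × r i p ≗ q)
  r-surjective zero n q (m , e , R) =
    q , (subst (λ z → Reach b z q) (suc-injective (trans (sym (*-identityʳ (suc m))) e)) R , λ _ ()) , λ _ → refl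
  r-surjective (suc i) n q (m , e , R)
    with r-surjective i (pred (suc m * b ^ i)) q (m , sym (suc-pred-multiple m i) , R)
  ... | p , P , r≗q =
    cons (b ∸ 1) p , InP-cons (suc-injective (trans (digit-step m _ i (sym (suc-pred-multiple m i))) e)) P , r≗q

r-injective : ∀ {b} i n p p′ → InP i b n p → InP i b n p′ → r i p ≗ r i p′ → p ≗ p′
r-injective i n p p′ (_ , prefix) (_ , prefix′) r≗r k with suc k ≤? i
... | yes k<i = trans (prefix k k<i) (sym (prefix′ k k<i))
... | no  k≮i = subst (λ z → p z ≡ p′ z) (m+[n∸m]≡n (≤-pred (≰⇒> k≮i))) (r≗r (k ∸ i))

lemma3 : (b n i : ℕ) → 2 ≤ b →
    ((p : Seq) → InP i b n p → InTarget i b n (r i p))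
    × ((p p′ : Seq) → InP i b n p → InP i b n p′ → r i p ≗ r i p′ → p ≗ p′)
    × ((q : Seq) → InTarget i b n q → Σ Seq (λ p → InP i b n p × r i p ≗ q))
lemma3 .(suc (suc _)) n i (s≤s (s≤s _)) = r-InTarget i n , r-injective i n , r-surjective i n
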